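{- For every integer $k\ge2$, the formal power series $$D_k(x,q_2,q_3,q_4):=\sum_{n\ge1}x^n\sum_{w\in\mathcal F_{n,k}}q_2^{\deg_2(G(w))}q_3^{\deg_3(G(w))}q_4^{\deg_4(G(w))}$$ is equal to $$\frac{q_2^4\left((q_3^2q_4+q_4)x-(q_3^2q_4^2-2q_2q_3^2q_4^2+q_3^4q_4)x^2-q_3^{2k}q_4^kx^k+(q_3^{2k+2}q_4^k-2q_2q_3^{2k}q_4^{k+1})x^{k+1}\right)}{q_4\left(1-(q_3^2+q_4q_3^2)x+(q_4q_3^4-q_2^2q_4^2q_3^2)x^2+q_2^2q_4^{k+1}q_3^{2k}x^{k+1}\right)}.$$
   Context: For integers $k\ge 2$, $n\ge1$, $\mathcal F_{n,k}$ is the set of binary words $w=w_1\cdots w_n$ with no $k$ consecutive $1$'s. $P(w)$ is the bargraph polyomino formed by the unit squares $[i-1,i]\times[j-1,j]$, $1\le i\le n$, $1\le j\le w_i+1$. $G(w)$ is the graph whose vertices are the corners of the cells of $P(w)$ and whose edges are the cell sides (unit segments that are a side of at least one cell). For a graph $G$, $\deg_i(G)$ is the number of vertices of $G$ of degree $i$ (every vertex of $G(w)$ has degree $2$, $3$ or $4$). -}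

module Defs where

open import Level using (Level)
open import Data.Bool using (Bool; true; false; _∧_; _∨_; if_then_else_; _≟_)
open import Data.Nat as ℕ using (ℕ; zero; suc; _≤ᵇ_; _≡ᵇ_)
open import Data.List using (List; []; _∷_; map; _++_; filter; replicate; length; upTo; concatMap; foldr)
open import Data.Product using (_×_; _,_)
open import Relation.Nullary using (¬?)
open import Relation.Binary.PropositionalEquality using (_≡_)
open import Data.List.Relation.Binary.Infix.Heterogeneous using (Infix)
open import Data.List.Relation.Binary.Infix.Heterogeneous.Properties using (infix?)
open import Algebra.Bundles using (CommutativeRing)

words : ℕ → List (List Bool)
words zero    = [] ∷ []
words (suc n) = map (false ∷_) (words n) ++ map (true ∷_) (words n)

HasRun : ℕ → List Bool → Set
HasRun k w = Infix _≡_ (replicate k true) w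

F : ℕ → ℕ → List (List Bool)
F n k = filter (λ w → ¬? (infix? _≟_ (replicate k true) w)) (words n)

-- height of column i (1-indexed) is w_i + 1; 0 outside 1..n
col : List Bool → ℕ → ℕ
col []      _             = 0
col (_ ∷ _) zero          = 0
col (b ∷ _) (suc zero)    = if b then 2 else 1
col (_ ∷ w) (suc (suc i)) = col w (suc i)

-- cell (i , j) = [i-1,i]×[j-1,j] belongs to P(w)  (1 ≤ i ≤ n, 1 ≤ j ≤ w_i+1)
cell : List Bool → ℕ → ℕ → Bool
cell w i j = (1 ≤ᵇ j) ∧ (j ≤ᵇ col w i)

isVertex : List Bool → ℕ → ℕ → Bool
isVertex w a b = cell w a b ∨ cell w (suc a) b ∨ cell w a (suc b) ∨ cell w (suc a) (suc b)

hEdge : List Bool → ℕ → ℕ → Bool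
hEdge w a b = cell w (suc a) b ∨ cell w (suc a) (suc b)

vEdge : List Bool → ℕ → ℕ → Bool
vEdge w a b = cell w a (suc b) ∨ cell w (suc a) (suc b)

toℕ : Bool → ℕ
toℕ true  = 1
toℕ false = 0

-- degree of vertex (a , b) in G(w): number of incident edges
-- (right, left, up, down); coordinates are ≥ 0 since all cells lie in the first quadrant
deg : List Bool → ℕ → ℕ → ℕ
deg w a b =
  toℕ (hEdge w a b) ℕ.+ left a ℕ.+ toℕ (vEdge w a b) ℕ.+ down b
  where
  left : ℕ → ℕ
  left zero    = 0
  left (suc a) = toℕ (hEdge w a b)
  down : ℕ → ℕ
  down zero    = 0
  down (suc b) = toℕ (vEdge w a b)

-- all lattice points that can possibly be vertices: 0 ≤ a ≤ n, 0 ≤ b ≤ 2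
points : List Bool → List (ℕ × ℕ)
points w = concatMap (λ a → map (λ b → a , b) (upTo 3)) (upTo (suc (length w)))

degCount : ℕ → List Bool → ℕ
degCount d w =
  length (filter (λ p → isVertex w (Data.Product.proj₁ p) (Data.Product.proj₂ p) Data.Bool.≟ true)
                 (filter (λ p → deg w (Data.Product.proj₁ p) (Data.Product.proj₂ p) ℕ.≟ d) (points w)))

module RingStuff {c ℓ : Level} (R : CommutativeRing c ℓ) where
  open CommutativeRing R

  pow : Carrier → ℕ → Carrier
  pow x zero    = 1#
  pow x (suc n) = x * pow x n

  sumR : List Carrier → Carrier
  sumR = foldr _+_ 0#

  -- polynomial in x given as a list of (exponent , coefficient) terms;
  -- coefficient of x^m
  coeff : List (ℕ × Carrier) → ℕ → Carrier
  coeff p m = sumR (map Data.Product.proj₂ (filter (λ t → Data.Product.proj₁ t ℕ.≟ m) p))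

  Dcoeff : ℕ → Carrier → Carrier → Carrier → ℕ → Carrier
  Dcoeff k q₂ q₃ q₄ zero = 0#
  Dcoeff k q₂ q₃ q₄ n@(suc _) =
    sumR (map (λ w → pow q₂ (degCount 2 w) * pow q₃ (degCount 3 w) * pow q₄ (degCount 4 w)) (F n k))

  cauchy : (ℕ → Carrier) → (ℕ → Carrier) → ℕ → Carrier
  cauchy p f m = sumR (map (λ i → p i * f (m ℕ.∸ i)) (upTo (suc m)))

-- The vertices of G(w) lie on the vertical lines x = a, and whether a point of such a line
-- is a vertex, and its degree, depend only on the heights of the two columns meeting there
-- (height 0 outside the word, 1 for a letter 0, 2 for a letter 1).  So the weight
-- q₂^deg₂ q₃^deg₃ q₄^deg₄ of w is a product of boundary weights μ(h, h′) over consecutive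
-- heights, and D_k is computed by a transfer matrix whose state is the height of the last
-- column and the length of the current run of 1's.  With Y the series of words following
-- a 0 and U that of words following a first 1, this gives
--   D = s₁xY + s₂xU,   Y = t₁ + αxY + β₁xU,   (1 − γx)U = (1 − γ^{k−1}x^{k−1})(t₂ + β₂xY),
-- where s, t, α, β, γ are boundary weights.  Eliminating U shows that D times
-- 1 − (α+γ)x + (αγ − β₁β₂)x² + β₁β₂γ^{k−1}x^{k+1} is a polynomial, and substituting the
-- boundary weights gives the stated fraction.
module Submission where

open import Defs
open import Level using (Level)
open import Data.Nat as ℕ using (ℕ; suc; _≥_)
open import Data.List using (List; []; _∷_)
open import Data.Product using (_,_)
open import Algebra.Bundles using (CommutativeRing)

open import Data.Bool as Bool using (Bool; true; false; _∧_; _∨_; if_then_else_)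
open import Data.Nat using (zero; _<_; _≤ᵇ_; s≤s; z≤n)
import Data.Nat.Properties as ℕ
open import Data.Nat.ListAction using (sum)
open import Data.Integer as ℤ using (ℤ; +_; -[1+_]; _⊖_; sign; ∣_∣)
import Data.Integer.Properties as ℤ
open import Data.Sign as Sign using (Sign)
open import Data.List using (map; filter; _++_; length; upTo; applyUpTo; concatMap; replicate)
open import Data.List.Properties using (length-++; length-map; filter-++; map-++; map-∘; map-cong; map-applyUpTo)
open import Data.List.Relation.Binary.Infix.Heterogeneous using (here; there)
open import Data.List.Relation.Binary.Infix.Heterogeneous.Properties using (infix?)
open import Data.List.Relation.Binary.Prefix.Heterogeneous using (Prefix; []; _∷_)
open import Data.Maybe using (Maybe; just; nothing)
open import Data.Product using (_×_; proj₁; proj₂)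
open import Data.Empty using (⊥-elim)
open import Relation.Nullary using (does; yes; no; ¬_; ¬?)
open import Relation.Nullary.Decidable using (dec-true; dec-false; does-⇔)
open import Relation.Unary using (Decidable)
import Relation.Binary.PropositionalEquality as ≡
open ≡ using (_≡_)
open import Function using (_∘_; id; _⇔_; mk⇔; Equivalence)
import Algebra.Solver.Ring.AlmostCommutativeRing as ACR

-- The ring solver with coefficients in ℤ, whose decidable equality lets it cancel terms.
module IntegerCoefficientSolver {c ℓ : Level} (R : CommutativeRing c ℓ) where
  open CommutativeRing R
  open import Algebra.Properties.Ring ring using (-0#≈0#; -‿involutive; -‿+-comm; -1*x≈-x)
  open import Algebra.Properties.Monoid.Mult.TCOptimised +-monoid using (1+×; ×-homo-+) renaming (_×_ to _·_)
  open import Algebra.Properties.Semiring.Mult.TCOptimised semiring using (×1-homo-*)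
  open import Relation.Binary.Reasoning.Setoid setoid

  ⟦_⟧ℤ : ℤ → Carrier
  ⟦ + n ⟧ℤ      = n · 1#
  ⟦ -[1+ n ] ⟧ℤ = - (suc n · 1#)

  private
    ⟦sign⟧ : Sign → Carrier
    ⟦sign⟧ Sign.+ = 1#
    ⟦sign⟧ Sign.- = - 1#

    ⟦sign⟧-* : ∀ s t → ⟦sign⟧ (s Sign.* t) ≈ ⟦sign⟧ s * ⟦sign⟧ t
    ⟦sign⟧-* Sign.+ t      = sym (*-identityˡ _)
    ⟦sign⟧-* Sign.- Sign.+ = sym (*-identityʳ _)
    ⟦sign⟧-* Sign.- Sign.- = sym (trans (-1*x≈-x _) (-‿involutive _))

    ⟦◃⟧ : ∀ s n → ⟦ s ℤ.◃ n ⟧ℤ ≈ ⟦sign⟧ s * (n · 1#)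
    ⟦◃⟧ s      zero    = sym (zeroʳ _)
    ⟦◃⟧ Sign.+ (suc n) = sym (*-identityˡ _)
    ⟦◃⟧ Sign.- (suc n) = sym (-1*x≈-x _)

    ⟦⟧≈sign*abs : ∀ i → ⟦ i ⟧ℤ ≈ ⟦sign⟧ (sign i) * (∣ i ∣ · 1#)
    ⟦⟧≈sign*abs (+ n)    = sym (*-identityˡ _)
    ⟦⟧≈sign*abs -[1+ n ] = sym (-1*x≈-x _)

    1+x-[1+y]≈x-y : ∀ x y → (1# + x) - (1# + y) ≈ x - y
    1+x-[1+y]≈x-y x y = begin
      (1# + x) - (1# + y)      ≈⟨ +-congˡ (-‿+-comm 1# y) ⟨
      (1# + x) + (- 1# + - y)  ≈⟨ +-congʳ (+-comm 1# x) ⟩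
      (x + 1#) + (- 1# + - y)  ≈⟨ +-assoc x 1# _ ⟩
      x + (1# + (- 1# + - y))  ≈⟨ +-congˡ (+-assoc 1# (- 1#) (- y)) ⟨
      x + ((1# - 1#) + - y)    ≈⟨ +-congˡ (+-congʳ (-‿inverseʳ 1#)) ⟩
      x + (0# + - y)           ≈⟨ +-congˡ (+-identityˡ (- y)) ⟩
      x - y                    ∎

    ⟦⊖⟧ : ∀ m n → ⟦ m ⊖ n ⟧ℤ ≈ m · 1# - n · 1#
    ⟦⊖⟧ zero    zero    = sym (trans (+-congˡ -0#≈0#) (+-identityʳ _))
    ⟦⊖⟧ (suc m) zero    = sym (trans (+-congˡ -0#≈0#) (+-identityʳ _))
    ⟦⊖⟧ zero    (suc n) = sym (+-identityˡ _)
    ⟦⊖⟧ (suc m) (suc n) = begin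
      ⟦ suc m ⊖ suc n ⟧ℤ             ≡⟨ ≡.cong ⟦_⟧ℤ (ℤ.[1+m]⊖[1+n]≡m⊖n m n) ⟩
      ⟦ m ⊖ n ⟧ℤ                     ≈⟨ ⟦⊖⟧ m n ⟩
      m · 1# - n · 1#                ≈⟨ 1+x-[1+y]≈x-y (m · 1#) (n · 1#) ⟨
      (1# + m · 1#) - (1# + n · 1#)  ≈⟨ +-cong (1+× m 1#) (-‿cong (1+× n 1#)) ⟨
      suc m · 1# - suc n · 1#        ∎

    +-homo : ∀ i j → ⟦ i ℤ.+ j ⟧ℤ ≈ ⟦ i ⟧ℤ + ⟦ j ⟧ℤ
    +-homo -[1+ m ] -[1+ n ] = begin
      - (suc (suc (m ℕ.+ n)) · 1#)     ≡⟨ ≡.cong (λ z → - (suc z · 1#)) (≡.sym (ℕ.+-suc m n)) ⟩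
      - ((suc m ℕ.+ suc n) · 1#)       ≈⟨ -‿cong (×-homo-+ 1# (suc m) (suc n)) ⟩
      - (suc m · 1# + suc n · 1#)      ≈⟨ -‿+-comm _ _ ⟨
      - (suc m · 1#) + - (suc n · 1#)  ∎
    +-homo -[1+ m ] (+ n)    = trans (⟦⊖⟧ n (suc m)) (+-comm _ _)
    +-homo (+ m)    -[1+ n ] = ⟦⊖⟧ m (suc n)
    +-homo (+ m)    (+ n)    = ×-homo-+ 1# m n

    *-homo : ∀ i j → ⟦ i ℤ.* j ⟧ℤ ≈ ⟦ i ⟧ℤ * ⟦ j ⟧ℤ
    *-homo i j = begin
      ⟦ (sign i Sign.* sign j) ℤ.◃ (∣ i ∣ ℕ.* ∣ j ∣) ⟧ℤ
        ≈⟨ ⟦◃⟧ (sign i Sign.* sign j) (∣ i ∣ ℕ.* ∣ j ∣) ⟩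
      ⟦sign⟧ (sign i Sign.* sign j) * ((∣ i ∣ ℕ.* ∣ j ∣) · 1#)
        ≈⟨ *-cong (⟦sign⟧-* (sign i) (sign j)) (×1-homo-* ∣ i ∣ ∣ j ∣) ⟩
      (⟦sign⟧ (sign i) * ⟦sign⟧ (sign j)) * ((∣ i ∣ · 1#) * (∣ j ∣ · 1#))
        ≈⟨ interchange _ _ _ _ ⟩
      (⟦sign⟧ (sign i) * (∣ i ∣ · 1#)) * (⟦sign⟧ (sign j) * (∣ j ∣ · 1#))
        ≈⟨ *-cong (⟦⟧≈sign*abs i) (⟦⟧≈sign*abs j) ⟨
      ⟦ i ⟧ℤ * ⟦ j ⟧ℤ ∎
      where
      interchange : ∀ a b x y → (a * b) * (x * y) ≈ (a * x) * (b * y)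
      interchange a b x y = begin
        (a * b) * (x * y)  ≈⟨ *-assoc a b _ ⟩
        a * (b * (x * y))  ≈⟨ *-congˡ (*-assoc b x y) ⟨
        a * ((b * x) * y)  ≈⟨ *-congˡ (*-congʳ (*-comm b x)) ⟩
        a * ((x * b) * y)  ≈⟨ *-congˡ (*-assoc x b y) ⟩
        a * (x * (b * y))  ≈⟨ *-assoc a x _ ⟨
        (a * x) * (b * y)  ∎

    -‿homo : ∀ i → ⟦ ℤ.- i ⟧ℤ ≈ - ⟦ i ⟧ℤ
    -‿homo -[1+ n ]  = sym (-‿involutive _)
    -‿homo (+ zero)  = sym -0#≈0#
    -‿homo (+ suc n) = refl

    homomorphism : ℤ.+-*-rawRing ACR.-Raw-AlmostCommutative⟶ ACR.fromCommutativeRing R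
    homomorphism = record
      { ⟦_⟧ = ⟦_⟧ℤ ; +-homo = +-homo ; *-homo = *-homo ; -‿homo = -‿homo
      ; 0-homo = refl ; 1-homo = refl }

    ⟦⟧-equal? : ∀ i j → Maybe (⟦ i ⟧ℤ ≈ ⟦ j ⟧ℤ)
    ⟦⟧-equal? i j with i ℤ.≟ j
    ... | yes ≡.refl = just refl
    ... | no _       = nothing

  open import Algebra.Solver.Ring ℤ.+-*-rawRing (ACR.fromCommutativeRing R) homomorphism ⟦⟧-equal? public

module LinearCombination {c ℓ : Level} (R : CommutativeRing c ℓ) where
  open CommutativeRing R

  ≈-by-combination : ∀ {l r x} → l ≈ r + x → x ≈ 0# → l ≈ r
  ≈-by-combination {r = r} l≈r+x x≈0 = trans l≈r+x (trans (+-congˡ x≈0) (+-identityʳ r))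

  residual≈0 : ∀ a {l r} → l ≈ r → a * (l - r) ≈ 0#
  residual≈0 a {r = r} l≈r = trans (*-congˡ (trans (+-congʳ l≈r) (-‿inverseʳ r))) (zeroʳ a)

  infixr 5 _⊕0_
  _⊕0_ : ∀ {x y} → x ≈ 0# → y ≈ 0# → x + y ≈ 0#
  x≈0 ⊕0 y≈0 = trans (+-cong x≈0 y≈0) (+-identityʳ 0#)

module FilterCounting where
  open ≡ using (refl; cong)

  module _ {a b p} {A : Set a} {B : Set b} {P : A → Set p} {P′ : B → Set p}
           (P? : Decidable P) (P′? : Decidable P′) (f : B → A) where

    filter-map-agree : (∀ x → does (P? (f x)) ≡ does (P′? x)) →
                       ∀ xs → filter P? (map f xs) ≡ map f (filter P′? xs)
    filter-map-agree agree []       = refl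
    filter-map-agree agree (x ∷ xs) with does (P? (f x)) | does (P′? x) | agree x
    ... | true  | .true  | refl = cong (f x ∷_) (filter-map-agree agree xs)
    ... | false | .false | refl = filter-map-agree agree xs

  module _ {a p q} {A : Set a} {P : A → Set p} {Q : A → Set q}
           (P? : Decidable P) (Q? : Decidable Q) where

    length-filter²-concatMap : ∀ {b} {B : Set b} (F : B → List A) xs →
      length (filter P? (filter Q? (concatMap F xs)))
      ≡ sum (map (λ x → length (filter P? (filter Q? (F x)))) xs)
    length-filter²-concatMap F []       = refl
    length-filter²-concatMap F (x ∷ xs) = begin
      length (filter P? (filter Q? (F x ++ concatMap F xs)))
        ≡⟨ cong (length ∘ filter P?) (filter-++ Q? (F x) (concatMap F xs)) ⟩
      length (filter P? (filter Q? (F x) ++ filter Q? (concatMap F xs)))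
        ≡⟨ cong length (filter-++ P? (filter Q? (F x)) _) ⟩
      length (filter P? (filter Q? (F x)) ++ filter P? (filter Q? (concatMap F xs)))
        ≡⟨ length-++ (filter P? (filter Q? (F x))) ⟩
      length (filter P? (filter Q? (F x))) ℕ.+ length (filter P? (filter Q? (concatMap F xs)))
        ≡⟨ cong (length (filter P? (filter Q? (F x))) ℕ.+_) (length-filter²-concatMap F xs) ⟩
      sum (map (λ x → length (filter P? (filter Q? (F x)))) (x ∷ xs)) ∎
      where open ≡.≡-Reasoning

module Bargraph where
  open ≡ using (refl; sym; trans; cong; cong₂)
  open FilterCounting

  height : Bool → ℕ
  height b = if b then 2 else 1

  filled : ℕ → ℕ → Bool
  filled h j = (1 ≤ᵇ j) ∧ (j ≤ᵇ h)

  -- The point at height b on the line between a column of height l and one of height r.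
  boundaryVertex : ℕ → ℕ → ℕ → Bool
  boundaryVertex l r b = filled l b ∨ filled r b ∨ filled l (suc b) ∨ filled r (suc b)

  boundaryDeg : ℕ → ℕ → ℕ → ℕ
  boundaryDeg l r b =
    toℕ (filled r b ∨ filled r (suc b)) ℕ.+ toℕ (filled l b ∨ filled l (suc b))
    ℕ.+ toℕ (filled l (suc b) ∨ filled r (suc b)) ℕ.+ toℕ (filled l b ∨ filled r b)

  deg≡boundaryDeg : ∀ w a b → deg w a b ≡ boundaryDeg (col w a) (col w (suc a)) b
  deg≡boundaryDeg []      zero    zero    = refl
  deg≡boundaryDeg []      zero    (suc b) = refl
  deg≡boundaryDeg (_ ∷ _) zero    zero    = refl
  deg≡boundaryDeg (_ ∷ _) zero    (suc b) = refl
  deg≡boundaryDeg w       (suc a) zero    = refl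
  deg≡boundaryDeg w       (suc a) (suc b) = refl

  boundaryCount : ℕ → ℕ → ℕ → ℕ
  boundaryCount d l r =
    length (filter (λ b → boundaryVertex l r b Bool.≟ true) (filter (λ b → boundaryDeg l r b ℕ.≟ d) (upTo 3)))

  boundarySum : (ℕ → ℕ → ℕ) → ℕ → List Bool → ℕ
  boundarySum g h []      = g h 0
  boundarySum g h (b ∷ w) = g h (height b) ℕ.+ boundarySum g (height b) w

  -- Column heights of the bargraph of w preceded by an extra column of height h.
  colFrom : ℕ → List Bool → ℕ → ℕ
  colFrom h w       zero    = h
  colFrom h []      (suc i) = 0
  colFrom h (b ∷ w) (suc i) = colFrom (height b) w i

  colFrom-suc : ∀ h w i → colFrom h w (suc i) ≡ col w (suc i)
  colFrom-suc h []      i       = refl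
  colFrom-suc h (b ∷ w) zero    = refl
  colFrom-suc h (b ∷ w) (suc i) = colFrom-suc (height b) w i

  col≡colFrom : ∀ w i → col w i ≡ colFrom 0 w i
  col≡colFrom []      zero    = refl
  col≡colFrom (_ ∷ _) zero    = refl
  col≡colFrom w       (suc i) = sym (colFrom-suc 0 w i)

  sum-applyUpTo≡boundarySum : ∀ g h w →
    sum (applyUpTo (λ a → g (colFrom h w a) (colFrom h w (suc a))) (suc (length w))) ≡ boundarySum g h w
  sum-applyUpTo≡boundarySum g h []      = ℕ.+-identityʳ (g h 0)
  sum-applyUpTo≡boundarySum g h (b ∷ w) = cong (g h (height b) ℕ.+_) (sum-applyUpTo≡boundarySum g (height b) w)

  pointCount≡boundaryCount : ∀ d w a →
    length (filter (λ p → isVertex w (proj₁ p) (proj₂ p) Bool.≟ true)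
                   (filter (λ p → deg w (proj₁ p) (proj₂ p) ℕ.≟ d) (map (a ,_) (upTo 3))))
    ≡ boundaryCount d (col w a) (col w (suc a))
  pointCount≡boundaryCount d w a = begin
    length (filter V? (filter D? (map (a ,_) (upTo 3))))
      ≡⟨ cong (length ∘ filter V?) (filter-map-agree D? D′? (a ,_) D-agree (upTo 3)) ⟩
    length (filter V? (map (a ,_) (filter D′? (upTo 3))))
      ≡⟨ cong length (filter-map-agree V? V′? (a ,_) (λ _ → refl) (filter D′? (upTo 3))) ⟩
    length (map (a ,_) (filter V′? (filter D′? (upTo 3))))
      ≡⟨ length-map (a ,_) (filter V′? (filter D′? (upTo 3))) ⟩
    boundaryCount d (col w a) (col w (suc a)) ∎
    where
    open ≡.≡-Reasoning
    V? = λ p → isVertex w (proj₁ p) (proj₂ p) Bool.≟ true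
    D? = λ p → deg w (proj₁ p) (proj₂ p) ℕ.≟ d
    V′? = λ b → boundaryVertex (col w a) (col w (suc a)) b Bool.≟ true
    D′? = λ b → boundaryDeg (col w a) (col w (suc a)) b ℕ.≟ d
    D-agree : ∀ b → does (D? (a , b)) ≡ does (D′? b)
    D-agree b = cong (λ n → does (n ℕ.≟ d)) (deg≡boundaryDeg w a b)

  degCount≡boundarySum : ∀ d w → degCount d w ≡ boundarySum (boundaryCount d) 0 w
  degCount≡boundarySum d w = begin
    degCount d w
      ≡⟨ length-filter²-concatMap V? D? (λ a → map (a ,_) (upTo 3)) (upTo (suc (length w))) ⟩
    sum (map (λ a → length (filter V? (filter D? (map (a ,_) (upTo 3))))) (upTo (suc (length w))))
      ≡⟨ cong sum (map-cong local (upTo (suc (length w)))) ⟩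
    sum (map (λ a → boundaryCount d (colFrom 0 w a) (colFrom 0 w (suc a))) (upTo (suc (length w))))
      ≡⟨ cong sum (map-applyUpTo id _ (suc (length w))) ⟩
    sum (applyUpTo (λ a → boundaryCount d (colFrom 0 w a) (colFrom 0 w (suc a))) (suc (length w)))
      ≡⟨ sum-applyUpTo≡boundarySum (boundaryCount d) 0 w ⟩
    boundarySum (boundaryCount d) 0 w ∎
    where
    open ≡.≡-Reasoning
    V? = λ p → isVertex w (proj₁ p) (proj₂ p) Bool.≟ true
    D? = λ p → deg w (proj₁ p) (proj₂ p) ℕ.≟ d
    local : ∀ a → length (filter V? (filter D? (map (a ,_) (upTo 3))))
                  ≡ boundaryCount d (colFrom 0 w a) (colFrom 0 w (suc a))
    local a = trans (pointCount≡boundaryCount d w a)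
                    (cong₂ (boundaryCount d) (col≡colFrom w a) (col≡colFrom w (suc a)))

module RunsOfOnes (k : ℕ) where
  open ≡ using (refl; cong)

  ones : ℕ → List Bool
  ones j = replicate j true

  ones-++-true : ∀ j w → ones j ++ true ∷ w ≡ ones (suc j) ++ w
  ones-++-true zero    w = refl
  ones-++-true (suc j) w = cong (true ∷_) (ones-++-true j w)

  ¬Prefix-ones-false : ∀ {n j w} → j < n → ¬ Prefix _≡_ (ones n) (ones j ++ false ∷ w)
  ¬Prefix-ones-false {j = zero}  (s≤s _)   (() ∷ _)
  ¬Prefix-ones-false {j = suc j} (s≤s j<n) (_ ∷ p) = ¬Prefix-ones-false j<n p

  ¬Prefix-ones : ∀ {n j} → j < n → ¬ Prefix _≡_ (ones n) (ones j ++ [])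
  ¬Prefix-ones {j = zero}  (s≤s _)   ()
  ¬Prefix-ones {j = suc j} (s≤s j<n) (_ ∷ p) = ¬Prefix-ones j<n p

  HasRun-ones-false⇔ : ∀ j {w} → j < k → HasRun k (ones j ++ false ∷ w) ⇔ HasRun k w
  HasRun-ones-false⇔ j j<k = mk⇔ (to j j<k) (from j)
    where
    to : ∀ j {w} → j < k → HasRun k (ones j ++ false ∷ w) → HasRun k w
    to zero    j<k (here p)  = ⊥-elim (¬Prefix-ones-false j<k p)
    to zero    j<k (there r) = r
    to (suc j) j<k (here p)  = ⊥-elim (¬Prefix-ones-false j<k p)
    to (suc j) j<k (there r) = to j (ℕ.<⇒≤ j<k) r
    from : ∀ j {w} → HasRun k w → HasRun k (ones j ++ false ∷ w)
    from zero    r = there r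
    from (suc j) r = there (from j r)

  ¬HasRun-ones : ∀ j → j < k → ¬ HasRun k (ones j ++ [])
  ¬HasRun-ones zero    j<k (here p)  = ¬Prefix-ones j<k p
  ¬HasRun-ones (suc j) j<k (here p)  = ¬Prefix-ones j<k p
  ¬HasRun-ones (suc j) j<k (there r) = ¬HasRun-ones j (ℕ.<⇒≤ j<k) r

  HasRun-ones : ∀ w → HasRun k (ones k ++ w)
  HasRun-ones w = here (prefix k)
    where
    prefix : ∀ n → Prefix _≡_ (ones n) (ones n ++ w)
    prefix zero    = []
    prefix (suc n) = refl ∷ prefix n

  admissible : ℕ → List Bool → Bool
  admissible j w = does (¬? (infix? Bool._≟_ (ones k) (ones j ++ w)))

  admissible-[] : ∀ j → j < k → admissible j [] ≡ true
  admissible-[] j j<k = dec-true (¬? (infix? Bool._≟_ (ones k) (ones j ++ []))) (¬HasRun-ones j j<k)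

  admissible-false : ∀ j w → j < k → admissible j (false ∷ w) ≡ admissible 0 w
  admissible-false j w j<k =
    does-⇔ (mk⇔ (λ ¬r r → ¬r (from r)) (λ ¬r r → ¬r (to r)))
           (¬? (infix? Bool._≟_ (ones k) (ones j ++ false ∷ w))) (¬? (infix? Bool._≟_ (ones k) w))
    where open Equivalence (HasRun-ones-false⇔ j {w} j<k)

  admissible-true : ∀ j w → admissible j (true ∷ w) ≡ admissible (suc j) w
  admissible-true j w = cong (λ v → does (¬? (infix? Bool._≟_ (ones k) v))) (ones-++-true j w)

  admissible-run : ∀ w → admissible k w ≡ false
  admissible-run w = dec-false (¬? (infix? Bool._≟_ (ones k) (ones k ++ w))) (λ ¬r → ¬r (HasRun-ones w))

module PowerSeries {c ℓ : Level} (R : CommutativeRing c ℓ) where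
  open CommutativeRing R
  open RingStuff R
  open import Relation.Binary.Reasoning.Setoid setoid

  sumR-++ : ∀ xs ys → sumR (xs ++ ys) ≈ sumR xs + sumR ys
  sumR-++ []       ys = sym (+-identityˡ _)
  sumR-++ (x ∷ xs) ys = trans (+-congˡ (sumR-++ xs ys)) (sym (+-assoc _ _ _))

  module _ {a} {A : Set a} where

    sumR-map-cong : ∀ {f g : A → Carrier} → (∀ x → f x ≈ g x) → ∀ xs → sumR (map f xs) ≈ sumR (map g xs)
    sumR-map-cong f≈g []       = refl
    sumR-map-cong f≈g (x ∷ xs) = +-cong (f≈g x) (sumR-map-cong f≈g xs)

    sumR-map-+ : ∀ (f g : A → Carrier) xs → sumR (map (λ x → f x + g x) xs) ≈ sumR (map f xs) + sumR (map g xs)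
    sumR-map-+ f g []       = sym (+-identityʳ 0#)
    sumR-map-+ f g (x ∷ xs) = begin
      (f x + g x) + sumR (map (λ x → f x + g x) xs)   ≈⟨ +-congˡ (sumR-map-+ f g xs) ⟩
      (f x + g x) + (sumR (map f xs) + sumR (map g xs)) ≈⟨ +-assoc (f x) (g x) _ ⟩
      f x + (g x + (sumR (map f xs) + sumR (map g xs))) ≈⟨ +-congˡ (+-assoc (g x) _ _) ⟨
      f x + ((g x + sumR (map f xs)) + sumR (map g xs)) ≈⟨ +-congˡ (+-congʳ (+-comm (g x) _)) ⟩
      f x + ((sumR (map f xs) + g x) + sumR (map g xs)) ≈⟨ +-congˡ (+-assoc _ (g x) _) ⟩
      f x + (sumR (map f xs) + (g x + sumR (map g xs))) ≈⟨ +-assoc (f x) _ _ ⟨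
      (f x + sumR (map f xs)) + (g x + sumR (map g xs)) ∎

    sumR-map-*ˡ : ∀ a (f : A → Carrier) xs → sumR (map (λ x → a * f x) xs) ≈ a * sumR (map f xs)
    sumR-map-*ˡ a f []       = sym (zeroʳ a)
    sumR-map-*ˡ a f (x ∷ xs) = trans (+-congˡ (sumR-map-*ˡ a f xs)) (sym (distribˡ a (f x) _))

    sumR-map-0 : ∀ xs → sumR (map (λ (_ : A) → 0#) xs) ≈ 0#
    sumR-map-0 []       = refl
    sumR-map-0 (x ∷ xs) = trans (+-identityˡ _) (sumR-map-0 xs)

    sumR-map-filter : ∀ {p} {P : A → Set p} (P? : Decidable P) (f : A → Carrier) xs →
      sumR (map f (filter P? xs)) ≈ sumR (map (λ x → if does (P? x) then f x else 0#) xs)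
    sumR-map-filter P? f []       = refl
    sumR-map-filter P? f (x ∷ xs) with does (P? x)
    ... | true  = +-congˡ (sumR-map-filter P? f xs)
    ... | false = trans (sumR-map-filter P? f xs) (sym (+-identityˡ _))

  -- A series is its coefficient sequence; shift e f is x^e f(x), and termwise ps f is
  -- p(x) f(x) for the polynomial p with a term a x^e for each (e , a) in ps.
  Series : Set c
  Series = ℕ → Carrier

  shift : ℕ → Series → Series
  shift zero    f m       = f m
  shift (suc e) f zero    = 0#
  shift (suc e) f (suc m) = shift e f m

  unit : Series
  unit zero    = 1#
  unit (suc _) = 0#

  termwise : List (ℕ × Carrier) → Series → Series
  termwise ps f m = sumR (map (λ t → proj₂ t * shift (proj₁ t) f m) ps)

  monomial : ℕ → Carrier → Series
  monomial e a i = if does (e ℕ.≟ i) then a else 0#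

  coeff-∷ : ∀ e a ps i → coeff ((e , a) ∷ ps) i ≈ monomial e a i + coeff ps i
  coeff-∷ e a ps i with does (e ℕ.≟ i)
  ... | true  = refl
  ... | false = sym (+-identityˡ _)

  monomial≈shift-unit : ∀ e a m → monomial e a m ≈ a * shift e unit m
  monomial≈shift-unit zero    a zero    = sym (*-identityʳ a)
  monomial≈shift-unit zero    a (suc m) = sym (zeroʳ a)
  monomial≈shift-unit (suc e) a zero    = sym (zeroʳ a)
  monomial≈shift-unit (suc e) a (suc m) = monomial≈shift-unit e a m

  coeff≈termwise-unit : ∀ ps m → coeff ps m ≈ termwise ps unit m
  coeff≈termwise-unit []             m = refl
  coeff≈termwise-unit ((e , a) ∷ ps) m =
    trans (coeff-∷ e a ps m) (+-cong (monomial≈shift-unit e a m) (coeff≈termwise-unit ps m))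

  cauchy-suc : ∀ p f m → cauchy p f (suc m) ≡ p 0 * f (suc m) + cauchy (p ∘ suc) f m
  cauchy-suc p f m = ≡.cong (λ xs → p 0 * f (suc m) + sumR xs)
    (≡.trans (map-applyUpTo suc (λ i → p i * f (suc m ℕ.∸ i)) (suc m))
             (≡.sym (map-applyUpTo id (λ i → p (suc i) * f (m ℕ.∸ i)) (suc m))))

  cauchy-cong : ∀ {p q} f m → (∀ i → p i ≈ q i) → cauchy p f m ≈ cauchy q f m
  cauchy-cong f m p≈q = sumR-map-cong (λ i → *-congʳ (p≈q i)) (upTo (suc m))

  cauchy-+ : ∀ p q f m → cauchy (λ i → p i + q i) f m ≈ cauchy p f m + cauchy q f m
  cauchy-+ p q f m = trans (sumR-map-cong (λ i → distribʳ (f (m ℕ.∸ i)) (p i) (q i)) (upTo (suc m)))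
                           (sumR-map-+ (λ i → p i * f (m ℕ.∸ i)) (λ i → q i * f (m ℕ.∸ i)) (upTo (suc m)))

  cauchy-0 : ∀ f m → cauchy (λ _ → 0#) f m ≈ 0#
  cauchy-0 f m = trans (sumR-map-*ˡ 0# (λ i → f (m ℕ.∸ i)) (upTo (suc m))) (zeroˡ _)

  cauchy-monomial : ∀ e a f m → cauchy (monomial e a) f m ≈ a * shift e f m
  cauchy-monomial zero    a f zero    = +-identityʳ _
  cauchy-monomial (suc e) a f zero    = trans (+-identityʳ _) (trans (zeroˡ _) (sym (zeroʳ a)))
  cauchy-monomial zero    a f (suc m) = begin
    cauchy (monomial 0 a) f (suc m)        ≡⟨ cauchy-suc (monomial 0 a) f m ⟩
    a * f (suc m) + cauchy (λ _ → 0#) f m  ≈⟨ +-congˡ (cauchy-0 f m) ⟩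
    a * f (suc m) + 0#                     ≈⟨ +-identityʳ _ ⟩
    a * f (suc m)                          ∎
  cauchy-monomial (suc e) a f (suc m) = begin
    cauchy (monomial (suc e) a) f (suc m)      ≡⟨ cauchy-suc (monomial (suc e) a) f m ⟩
    0# * f (suc m) + cauchy (monomial e a) f m ≈⟨ +-cong (zeroˡ _) (cauchy-monomial e a f m) ⟩
    0# + a * shift e f m                       ≈⟨ +-identityˡ _ ⟩
    a * shift e f m                            ∎

  cauchy-coeff : ∀ ps f m → cauchy (coeff ps) f m ≈ termwise ps f m
  cauchy-coeff []             f m = cauchy-0 f m
  cauchy-coeff ((e , a) ∷ ps) f m = begin
    cauchy (coeff ((e , a) ∷ ps)) f m                       ≈⟨ cauchy-cong f m (coeff-∷ e a ps) ⟩
    cauchy (λ i → monomial e a i + coeff ps i) f m          ≈⟨ cauchy-+ (monomial e a) (coeff ps) f m ⟩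
    cauchy (monomial e a) f m + cauchy (coeff ps) f m       ≈⟨ +-cong (cauchy-monomial e a f m) (cauchy-coeff ps f m) ⟩
    termwise ((e , a) ∷ ps) f m                             ∎

  -- U j is the truncated geometric series Σ_{i < k − j} (γx)^i G, characterised by
  -- (1 − γx) U j = (1 − (γx)^(k − j)) G.
  module _ (G : Series) (γ : Carrier) (U : ℕ → Series) (k : ℕ)
           (U-step : ∀ j → j < k → ∀ m → U j m ≈ G m + γ * shift 1 (U (suc j)) m)
           (U-last : ∀ m → U k m ≈ 0#)
           where

    truncated-geometric : ∀ d j → j ℕ.+ d ≡ k → ∀ m → U j m + pow γ d * shift d G m ≈ G m + γ * shift 1 (U j) m
    truncated-geometric zero j j+0≡k m = begin
      U j m + 1# * G m           ≈⟨ +-cong (U-last′ m) (*-identityˡ (G m)) ⟩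
      0# + G m                   ≈⟨ +-identityˡ (G m) ⟩
      G m                        ≈⟨ +-identityʳ (G m) ⟨
      G m + 0#                   ≈⟨ +-congˡ (zeroʳ γ) ⟨
      G m + γ * 0#               ≈⟨ +-congˡ (*-congˡ (shift-U-last m)) ⟨
      G m + γ * shift 1 (U j) m  ∎
      where
      U-last′ : ∀ m → U j m ≈ 0#
      U-last′ = ≡.subst (λ i → ∀ m → U i m ≈ 0#) (≡.sym (≡.trans (≡.sym (ℕ.+-identityʳ j)) j+0≡k)) U-last
      shift-U-last : ∀ m → shift 1 (U j) m ≈ 0#
      shift-U-last zero    = refl
      shift-U-last (suc m) = U-last′ m
    truncated-geometric (suc d) j j+d+1≡k zero = begin
      U j 0 + γ * pow γ d * 0#  ≈⟨ +-cong (U-step j j<k 0) (zeroʳ _) ⟩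
      (G 0 + γ * 0#) + 0#       ≈⟨ +-identityʳ _ ⟩
      G 0 + γ * 0#              ∎
      where
      j<k : j < k
      j<k = ≡.subst (j <_) j+d+1≡k (ℕ.m<m+n j (s≤s z≤n))
    truncated-geometric (suc d) j j+d+1≡k (suc m) = begin
      U j (suc m) + γ * pow γ d * shift d G m
        ≈⟨ +-cong (U-step j j<k (suc m)) (*-assoc γ _ _) ⟩
      (G (suc m) + γ * U (suc j) m) + γ * (pow γ d * shift d G m)
        ≈⟨ +-assoc _ _ _ ⟩
      G (suc m) + (γ * U (suc j) m + γ * (pow γ d * shift d G m))
        ≈⟨ +-congˡ (distribˡ γ _ _) ⟨
      G (suc m) + γ * (U (suc j) m + pow γ d * shift d G m)
        ≈⟨ +-congˡ (*-congˡ (truncated-geometric d (suc j) sj+d≡k m)) ⟩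
      G (suc m) + γ * (G m + γ * shift 1 (U (suc j)) m)
        ≈⟨ +-congˡ (*-congˡ (U-step j j<k m)) ⟨
      G (suc m) + γ * U j m
        ∎
      where
      sj+d≡k : suc j ℕ.+ d ≡ k
      sj+d≡k = ≡.trans (≡.sym (ℕ.+-suc j d)) j+d+1≡k
      j<k : j < k
      j<k = ≡.subst (j <_) j+d+1≡k (ℕ.m<m+n j (s≤s z≤n))

  module Elimination
    (s₁ s₂ t₁ t₂ α β₁ β₂ γ κ : Carrier) (r : ℕ) (D Y U G : Series)
    (D-eq : ∀ m → D m ≈ s₁ * shift 1 Y m + s₂ * shift 1 U m)
    (Y-eq : ∀ m → Y m ≈ t₁ * unit m + α * shift 1 Y m + β₁ * shift 1 U m)
    (G-eq : ∀ m → G m ≈ t₂ * unit m + β₂ * shift 1 Y m)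
    (U-eq : ∀ m → U m + κ * shift r G m ≈ G m + γ * shift 1 U m)
    where

    open IntegerCoefficientSolver R
    open LinearCombination R

    private
      0≈a*0+b*0 : ∀ a b → 0# ≈ a * 0# + b * 0#
      0≈a*0+b*0 = solve 2 (λ a b → con (+ 0) := a :* con (+ 0) :+ b :* con (+ 0)) refl

    D-eq-shift : ∀ e m → shift e D m ≈ s₁ * shift (suc e) Y m + s₂ * shift (suc e) U m
    D-eq-shift zero    m       = D-eq m
    D-eq-shift (suc e) zero    = 0≈a*0+b*0 s₁ s₂
    D-eq-shift (suc e) (suc m) = D-eq-shift e m

    Y-eq-shift : ∀ e m → shift e Y m ≈ t₁ * shift e unit m + α * shift (suc e) Y m + β₁ * shift (suc e) U m
    Y-eq-shift zero    m       = Y-eq m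
    Y-eq-shift (suc e) zero    =
      solve 3 (λ a b c → con (+ 0) := a :* con (+ 0) :+ b :* con (+ 0) :+ c :* con (+ 0)) refl t₁ α β₁
    Y-eq-shift (suc e) (suc m) = Y-eq-shift e m

    G-eq-shift : ∀ e m → shift e G m ≈ t₂ * shift e unit m + β₂ * shift (suc e) Y m
    G-eq-shift zero    m       = G-eq m
    G-eq-shift (suc e) zero    = 0≈a*0+b*0 t₂ β₂
    G-eq-shift (suc e) (suc m) = G-eq-shift e m

    U-eq-shift₁ : ∀ m → shift 1 U m + κ * shift (suc r) G m ≈ shift 1 G m + γ * shift 2 U m
    U-eq-shift₁ zero    = solve 2 (λ a b → con (+ 0) :+ a :* con (+ 0) := con (+ 0) :+ b :* con (+ 0)) refl κ γ
    U-eq-shift₁ (suc m) = U-eq m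

    den : Series → Series
    den f m = f m - (α + γ) * shift 1 f m + (α * γ - β₁ * β₂) * shift 2 f m
            + β₁ * β₂ * κ * shift (suc (suc r)) f m

    numY numU : Series
    numY m = t₁ * unit m - t₁ * γ * shift 1 unit m + β₁ * t₂ * shift 1 unit m
           - β₁ * t₂ * κ * shift (suc r) unit m
    numU m = t₂ * unit m - t₂ * α * shift 1 unit m + t₁ * β₂ * shift 1 unit m
           - κ * (t₂ * shift r unit m - t₂ * α * shift (suc r) unit m + t₁ * β₂ * shift (suc r) unit m)

    -- The combination (1 − γx)·Y-eq + β₁x·U-eq + β₁x(1 − κx^r)·G-eq.
    den-Y : ∀ m → den Y m ≈ numY m
    den-Y m = ≈-by-combination
      (solve 18 (λ t₁ t₂ α β₁ β₂ γ κ Y₀ Y₁ Y₂ Yʳ₂ U₁ U₂ G₁ Gʳ₁ o₀ o₁ oʳ₁ →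
        Y₀ :- (α :+ γ) :* Y₁ :+ (α :* γ :- β₁ :* β₂) :* Y₂ :+ β₁ :* β₂ :* κ :* Yʳ₂
        := (t₁ :* o₀ :- t₁ :* γ :* o₁ :+ β₁ :* t₂ :* o₁ :- β₁ :* t₂ :* κ :* oʳ₁)
           :+ (con (+ 1) :* (Y₀ :- (t₁ :* o₀ :+ α :* Y₁ :+ β₁ :* U₁))
           :+ ((:- γ) :* (Y₁ :- (t₁ :* o₁ :+ α :* Y₂ :+ β₁ :* U₂))
           :+ (β₁ :* ((U₁ :+ κ :* Gʳ₁) :- (G₁ :+ γ :* U₂))
           :+ ((:- (β₁ :* κ)) :* (Gʳ₁ :- (t₂ :* oʳ₁ :+ β₂ :* Yʳ₂))
           :+ β₁ :* (G₁ :- (t₂ :* o₁ :+ β₂ :* Y₂)))))))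
        refl t₁ t₂ α β₁ β₂ γ κ (Y m) (shift 1 Y m) (shift 2 Y m) (shift (suc (suc r)) Y m)
        (shift 1 U m) (shift 2 U m) (shift 1 G m) (shift (suc r) G m)
        (unit m) (shift 1 unit m) (shift (suc r) unit m))
      (residual≈0 1# (Y-eq-shift 0 m) ⊕0 residual≈0 (- γ) (Y-eq-shift 1 m) ⊕0 residual≈0 β₁ (U-eq-shift₁ m)
        ⊕0 residual≈0 (- (β₁ * κ)) (G-eq-shift (suc r) m) ⊕0 residual≈0 β₁ (G-eq-shift 1 m))

    -- The combination (1 − αx)·U-eq + (1 − αx)(1 − κx^r)·G-eq + β₂x(1 − κx^r)·Y-eq.
    den-U : ∀ m → den U m ≈ numU m
    den-U m = ≈-by-combination
      (solve 23 (λ t₁ t₂ α β₁ β₂ γ κ U₀ U₁ U₂ Uʳ₂ Y₁ Y₂ Yʳ₁ Yʳ₂ G₀ Gʳ G₁ Gʳ₁ o₀ o₁ oʳ oʳ₁ →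
        U₀ :- (α :+ γ) :* U₁ :+ (α :* γ :- β₁ :* β₂) :* U₂ :+ β₁ :* β₂ :* κ :* Uʳ₂
        := (t₂ :* o₀ :- t₂ :* α :* o₁ :+ t₁ :* β₂ :* o₁
            :- κ :* (t₂ :* oʳ :- t₂ :* α :* oʳ₁ :+ t₁ :* β₂ :* oʳ₁))
           :+ (con (+ 1) :* ((U₀ :+ κ :* Gʳ) :- (G₀ :+ γ :* U₁))
           :+ ((:- κ) :* (Gʳ :- (t₂ :* oʳ :+ β₂ :* Yʳ₁))
           :+ (con (+ 1) :* (G₀ :- (t₂ :* o₀ :+ β₂ :* Y₁))
           :+ ((:- α) :* ((U₁ :+ κ :* Gʳ₁) :- (G₁ :+ γ :* U₂))
           :+ ((α :* κ) :* (Gʳ₁ :- (t₂ :* oʳ₁ :+ β₂ :* Yʳ₂))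
           :+ ((:- α) :* (G₁ :- (t₂ :* o₁ :+ β₂ :* Y₂))
           :+ (β₂ :* (Y₁ :- (t₁ :* o₁ :+ α :* Y₂ :+ β₁ :* U₂))
           :+ (:- (κ :* β₂)) :* (Yʳ₁ :- (t₁ :* oʳ₁ :+ α :* Yʳ₂ :+ β₁ :* Uʳ₂))))))))))
        refl t₁ t₂ α β₁ β₂ γ κ (U m) (shift 1 U m) (shift 2 U m) (shift (suc (suc r)) U m)
        (shift 1 Y m) (shift 2 Y m) (shift (suc r) Y m) (shift (suc (suc r)) Y m)
        (G m) (shift r G m) (shift 1 G m) (shift (suc r) G m)
        (unit m) (shift 1 unit m) (shift r unit m) (shift (suc r) unit m))
      (residual≈0 1# (U-eq m) ⊕0 residual≈0 (- κ) (G-eq-shift r m) ⊕0 residual≈0 1# (G-eq m)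
        ⊕0 residual≈0 (- α) (U-eq-shift₁ m) ⊕0 residual≈0 (α * κ) (G-eq-shift (suc r) m)
        ⊕0 residual≈0 (- α) (G-eq-shift 1 m) ⊕0 residual≈0 β₂ (Y-eq-shift 1 m)
        ⊕0 residual≈0 (- (κ * β₂)) (Y-eq-shift (suc r) m))

    den-D : ∀ m → den D m ≈ s₁ * shift 1 numY m + s₂ * shift 1 numU m
    den-D zero    = ≈-by-combination
      (solve 8 (λ s₁ s₂ α β₁ β₂ γ κ D₀ →
        D₀ :- (α :+ γ) :* con (+ 0) :+ (α :* γ :- β₁ :* β₂) :* con (+ 0) :+ β₁ :* β₂ :* κ :* con (+ 0)
        := s₁ :* con (+ 0) :+ s₂ :* con (+ 0) :+ con (+ 1) :* (D₀ :- (s₁ :* con (+ 0) :+ s₂ :* con (+ 0))))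
        refl s₁ s₂ α β₁ β₂ γ κ (D 0))
      (residual≈0 1# (D-eq 0))
    den-D (suc m) = begin
      den D (suc m)
        ≈⟨ +-cong (+-cong (+-cong (D-eq-shift 0 (suc m)) (-‿cong (*-congˡ (D-eq-shift 0 m))))
                          (*-congˡ (D-eq-shift 1 m)))
                  (*-congˡ (D-eq-shift (suc r) m)) ⟩
      (s₁ * Y m + s₂ * U m) - (α + γ) * (s₁ * shift 1 Y m + s₂ * shift 1 U m)
        + (α * γ - β₁ * β₂) * (s₁ * shift 2 Y m + s₂ * shift 2 U m)
        + β₁ * β₂ * κ * (s₁ * shift (suc (suc r)) Y m + s₂ * shift (suc (suc r)) U m)
        ≈⟨ solve 15 (λ s₁ s₂ α β₁ β₂ γ κ Y₀ Y₁ Y₂ Yʳ₂ U₀ U₁ U₂ Uʳ₂ →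
             (s₁ :* Y₀ :+ s₂ :* U₀) :- (α :+ γ) :* (s₁ :* Y₁ :+ s₂ :* U₁)
               :+ (α :* γ :- β₁ :* β₂) :* (s₁ :* Y₂ :+ s₂ :* U₂)
               :+ β₁ :* β₂ :* κ :* (s₁ :* Yʳ₂ :+ s₂ :* Uʳ₂)
             := s₁ :* (Y₀ :- (α :+ γ) :* Y₁ :+ (α :* γ :- β₁ :* β₂) :* Y₂ :+ β₁ :* β₂ :* κ :* Yʳ₂)
                :+ s₂ :* (U₀ :- (α :+ γ) :* U₁ :+ (α :* γ :- β₁ :* β₂) :* U₂ :+ β₁ :* β₂ :* κ :* Uʳ₂))
             refl s₁ s₂ α β₁ β₂ γ κ (Y m) (shift 1 Y m) (shift 2 Y m) (shift (suc (suc r)) Y m)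
             (U m) (shift 1 U m) (shift 2 U m) (shift (suc (suc r)) U m) ⟩
      s₁ * den Y m + s₂ * den U m
        ≈⟨ +-cong (*-congˡ (den-Y m)) (*-congˡ (den-U m)) ⟩
      s₁ * numY m + s₂ * numU m ∎

module Transfer {c ℓ : Level} (R : CommutativeRing c ℓ) (r : ℕ) (q₂ q₃ q₄ : CommutativeRing.Carrier R) where
  open CommutativeRing R
  open RingStuff R
  open PowerSeries R
  open IntegerCoefficientSolver R
  open Bargraph
  open LinearCombination R
  open RunsOfOnes (suc r)
  open import Relation.Binary.Reasoning.Setoid setoid

  k : ℕ
  k = suc r

  μ : ℕ → ℕ → Carrier
  μ l h = pow q₂ (boundaryCount 2 l h) * pow q₃ (boundaryCount 3 l h) * pow q₄ (boundaryCount 4 l h)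

  μ-poly : ∀ {n} → Polynomial n → Polynomial n → Polynomial n → ℕ → ℕ → Polynomial n
  μ-poly x y z l h = x :^ boundaryCount 2 l h :* y :^ boundaryCount 3 l h :* z :^ boundaryCount 4 l h

  weight : ℕ → List Bool → Carrier
  weight h w = pow q₂ (boundarySum (boundaryCount 2) h w) * pow q₃ (boundarySum (boundaryCount 3) h w)
             * pow q₄ (boundarySum (boundaryCount 4) h w)

  pow-+ : ∀ x m n → pow x (m ℕ.+ n) ≈ pow x m * pow x n
  pow-+ x zero    n = sym (*-identityˡ _)
  pow-+ x (suc m) n = trans (*-congˡ (pow-+ x m n)) (sym (*-assoc _ _ _))

  weight-∷ : ∀ h b w → weight h (b ∷ w) ≈ μ h (height b) * weight (height b) w
  weight-∷ h b w = trans (*-cong (*-cong (pow-+ q₂ (first 2) (rest 2)) (pow-+ q₃ (first 3) (rest 3))) (pow-+ q₄ (first 4) (rest 4)))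
    (solve 6 (λ a₂ b₂ a₃ b₃ a₄ b₄ → (a₂ :* b₂) :* (a₃ :* b₃) :* (a₄ :* b₄) := (a₂ :* a₃ :* a₄) :* (b₂ :* b₃ :* b₄))
      refl (pow q₂ (first 2)) (pow q₂ (rest 2)) (pow q₃ (first 3)) (pow q₃ (rest 3)) (pow q₄ (first 4)) (pow q₄ (rest 4)))
    where
    first rest : ℕ → ℕ
    first d = boundaryCount d h (height b)
    rest d = boundarySum (boundaryCount d) (height b) w

  -- Words of length n that follow a run of j ones ending in a column of height h.
  S : ℕ → ℕ → ℕ → Carrier
  S j h n = sumR (map (λ w → if admissible j w then weight h w else 0#) (words n))

  if-cong : ∀ b {x y} → x ≈ y → (if b then x else 0#) ≈ (if b then y else 0#)
  if-cong true  x≈y = x≈y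
  if-cong false x≈y = refl

  if-*ˡ : ∀ b a x → (if b then a * x else 0#) ≈ a * (if b then x else 0#)
  if-*ˡ true  a x = refl
  if-*ˡ false a x = sym (zeroʳ a)

  S-[] : ∀ j h → j < k → S j h 0 ≈ μ h 0
  S-[] j h j<k rewrite admissible-[] j j<k = +-identityʳ (μ h 0)

  S-run : ∀ h n → S k h n ≈ 0#
  S-run h n = trans (sumR-map-cong (λ w → reflexive (≡.cong (λ b → if b then weight h w else 0#) (admissible-run w))) (words n))
                    (sumR-map-0 (words n))

  S-∷ : ∀ j h n → j < k → S j h (suc n) ≈ μ h 1 * S 0 1 n + μ h 2 * S (suc j) 2 n
  S-∷ j h n j<k = begin
    sumR (map φ (map (false ∷_) (words n) ++ map (true ∷_) (words n)))
      ≡⟨ ≡.cong sumR (map-++ φ (map (false ∷_) (words n)) _) ⟩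
    sumR (map φ (map (false ∷_) (words n)) ++ map φ (map (true ∷_) (words n)))
      ≈⟨ sumR-++ (map φ (map (false ∷_) (words n))) _ ⟩
    sumR (map φ (map (false ∷_) (words n))) + sumR (map φ (map (true ∷_) (words n)))
      ≡⟨ ≡.cong₂ (λ xs ys → sumR xs + sumR ys) (≡.sym (map-∘ (words n))) (≡.sym (map-∘ (words n))) ⟩
    sumR (map (λ w → φ (false ∷ w)) (words n)) + sumR (map (λ w → φ (true ∷ w)) (words n))
      ≈⟨ +-cong (sumR-map-cong after-0 (words n)) (sumR-map-cong after-1 (words n)) ⟩
    sumR (map (λ w → μ h 1 * ψ 0 1 w) (words n)) + sumR (map (λ w → μ h 2 * ψ (suc j) 2 w) (words n))
      ≈⟨ +-cong (sumR-map-*ˡ (μ h 1) (ψ 0 1) (words n)) (sumR-map-*ˡ (μ h 2) (ψ (suc j) 2) (words n)) ⟩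
    μ h 1 * S 0 1 n + μ h 2 * S (suc j) 2 n ∎
    where
    ψ : ℕ → ℕ → List Bool → Carrier
    ψ i h′ w = if admissible i w then weight h′ w else 0#
    φ : List Bool → Carrier
    φ = ψ j h
    after-0 : ∀ w → φ (false ∷ w) ≈ μ h 1 * ψ 0 1 w
    after-0 w rewrite admissible-false j w j<k =
      trans (if-cong (admissible 0 w) (weight-∷ h false w)) (if-*ˡ (admissible 0 w) _ _)
    after-1 : ∀ w → φ (true ∷ w) ≈ μ h 2 * ψ (suc j) 2 w
    after-1 w rewrite admissible-true j w =
      trans (if-cong (admissible (suc j) w) (weight-∷ h true w)) (if-*ˡ (admissible (suc j) w) _ _)

  -- These evaluate to s₁ = t₁ = q₂², s₂ = t₂ = q₂²q₃, α = q₃², β₁ = β₂ = q₂q₃q₄ and γ = q₃²q₄.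
  s₁ s₂ t₁ t₂ α β₁ β₂ γ κ : Carrier
  s₁ = μ 0 1
  s₂ = μ 0 2
  t₁ = μ 1 0
  t₂ = μ 2 0
  α  = μ 1 1
  β₁ = μ 1 2
  β₂ = μ 2 1
  γ  = μ 2 2
  κ  = pow γ r

  D Y G : Series
  D = Dcoeff k q₂ q₃ q₄
  Y = S 0 1
  G m = t₂ * unit m + β₂ * shift 1 Y m

  U : ℕ → Series
  U j = S j 2

  D≈S : ∀ n → D (suc n) ≈ S 0 0 (suc n)
  D≈S n = trans (sumR-map-filter (λ w → ¬? (infix? Bool._≟_ (ones k) w)) W (words (suc n)))
                (sumR-map-cong (λ w → if-cong (admissible 0 w) (reflexive (W≡weight w))) (words (suc n)))
    where
    W : List Bool → Carrier
    W w = pow q₂ (degCount 2 w) * pow q₃ (degCount 3 w) * pow q₄ (degCount 4 w)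
    W≡weight : ∀ w → W w ≡ weight 0 w
    W≡weight w rewrite degCount≡boundarySum 2 w | degCount≡boundarySum 3 w | degCount≡boundarySum 4 w = ≡.refl

  0<k : 0 < k
  0<k = s≤s z≤n

  D-eq : ∀ m → D m ≈ s₁ * shift 1 Y m + s₂ * shift 1 (U 1) m
  D-eq zero    = solve 2 (λ a b → con (+ 0) := a :* con (+ 0) :+ b :* con (+ 0)) refl (s₁) (s₂)
  D-eq (suc n) = trans (D≈S n) (S-∷ 0 0 n 0<k)

  Y-eq : ∀ m → Y m ≈ t₁ * unit m + α * shift 1 Y m + β₁ * shift 1 (U 1) m
  Y-eq zero    = trans (S-[] 0 1 0<k)
    (solve 3 (λ a b c → a := a :* con (+ 1) :+ b :* con (+ 0) :+ c :* con (+ 0)) refl (t₁) (α) (β₁))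
  Y-eq (suc n) = trans (S-∷ 0 1 n 0<k)
    (solve 5 (λ a b c y u → b :* y :+ c :* u := a :* con (+ 0) :+ b :* y :+ c :* u) refl (t₁) (α) (β₁) (Y n) (U 1 n))

  U-step : ∀ j → j < k → ∀ m → U j m ≈ G m + γ * shift 1 (U (suc j)) m
  U-step j j<k zero    = trans (S-[] j 2 j<k)
    (solve 3 (λ a b c → a := a :* con (+ 1) :+ b :* con (+ 0) :+ c :* con (+ 0)) refl (t₂) (β₂) (γ))
  U-step j j<k (suc n) = trans (S-∷ j 2 n j<k)
    (solve 5 (λ a b c y u → b :* y :+ c :* u := a :* con (+ 0) :+ b :* y :+ c :* u) refl (t₂) (β₂) (γ) (Y n) (U (suc j) n))

  U-eq : ∀ m → U 1 m + pow (γ) r * shift r G m ≈ G m + γ * shift 1 (U 1) m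
  U-eq = truncated-geometric G (γ) U k U-step (S-run 2) r 1 ≡.refl

  G-eq : ∀ m → G m ≈ t₂ * unit m + β₂ * shift 1 Y m
  G-eq _ = refl

  open Elimination (s₁) (s₂) (t₁) (t₂) (α) (β₁) (β₂) (γ) (pow (γ) r) r
                   D Y (U 1) G D-eq Y-eq G-eq U-eq

  denominator numerator : List (ℕ × Carrier)
  denominator = (0 , 1#)
              ∷ (1 , - (pow q₃ 2 + q₄ * pow q₃ 2))
              ∷ (2 , (q₄ * pow q₃ 4 - pow q₂ 2 * pow q₄ 2 * pow q₃ 2))
              ∷ (suc k , pow q₂ 2 * pow q₄ (suc k) * pow q₃ (2 ℕ.* k))
              ∷ []
  numerator = (1 , (pow q₃ 2 * q₄ + q₄))
            ∷ (2 , - (pow q₃ 2 * pow q₄ 2 - (1# + 1#) * q₂ * pow q₃ 2 * pow q₄ 2 + pow q₃ 4 * q₄))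
            ∷ (k , - (pow q₃ (2 ℕ.* k) * pow q₄ k))
            ∷ (suc k , (pow q₃ (2 ℕ.* k ℕ.+ 2) * pow q₄ k - (1# + 1#) * q₂ * pow q₃ (2 ℕ.* k) * pow q₄ (suc k)))
            ∷ []

  pow-γ : ∀ n → pow q₃ (2 ℕ.* n) * pow q₄ n ≈ pow (γ) n
  pow-γ zero    = *-identityˡ 1#
  pow-γ (suc n) = begin
    pow q₃ (2 ℕ.* suc n) * pow q₄ (suc n)          ≡⟨ ≡.cong (λ e → pow q₃ e * pow q₄ (suc n)) (ℕ.*-suc 2 n) ⟩
    q₃ * (q₃ * pow q₃ (2 ℕ.* n)) * (q₄ * pow q₄ n)
      ≈⟨ solve 4 (λ x y a b → x :* (x :* a) :* (y :* b) := μ-poly x x y 2 2 :* (a :* b)) refl q₃ q₄ (pow q₃ (2 ℕ.* n)) (pow q₄ n) ⟩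
    γ * (pow q₃ (2 ℕ.* n) * pow q₄ n)           ≈⟨ *-congˡ (pow-γ n) ⟩
    pow (γ) (suc n)                             ∎

  denominator-match : ∀ m → termwise denominator D m ≈ den D m
  denominator-match m = ≈-by-combination
    (solve 10 (λ x₂ x₃ x₄ p₃ p₄ κ D₀ D₁ D₂ Dᵏ⁺¹ →
      let α = μ-poly x₂ x₃ x₄ 1 1 ; β₁ = μ-poly x₂ x₃ x₄ 1 2 ; β₂ = μ-poly x₂ x₃ x₄ 2 1 ; γ = μ-poly x₂ x₃ x₄ 2 2 in
      con (+ 1) :* D₀ :+ ((:- (x₃ :^ 2 :+ x₄ :* x₃ :^ 2)) :* D₁
        :+ ((x₄ :* x₃ :^ 4 :- x₂ :^ 2 :* x₄ :^ 2 :* x₃ :^ 2) :* D₂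
        :+ ((x₂ :^ 2 :* (x₄ :* p₄) :* p₃) :* Dᵏ⁺¹ :+ con (+ 0))))
      := (D₀ :- (α :+ γ) :* D₁ :+ (α :* γ :- β₁ :* β₂) :* D₂ :+ β₁ :* β₂ :* κ :* Dᵏ⁺¹)
         :+ (x₂ :^ 2 :* x₄ :* Dᵏ⁺¹) :* (p₃ :* p₄ :- γ :* κ))
      refl q₂ q₃ q₄ (pow q₃ (2 ℕ.* k)) (pow q₄ k) (pow (γ) r)
      (D m) (shift 1 D m) (shift 2 D m) (shift (suc k) D m))
    (residual≈0 (pow q₂ 2 * q₄ * shift (suc k) D m) (pow-γ k))

  numerator-match : ∀ m → q₄ * (s₁ * shift 1 numY m + s₂ * shift 1 numU m) ≈ pow q₂ 4 * termwise numerator unit m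
  numerator-match zero    =
    solve 8 (λ x a b c₁ c₂ c₃ c₄ y →
      x :* (a :* con (+ 0) :+ b :* con (+ 0))
      := y :* (c₁ :* con (+ 0) :+ (c₂ :* con (+ 0) :+ (c₃ :* con (+ 0) :+ (c₄ :* con (+ 0) :+ con (+ 0))))))
      refl q₄ (s₁) (s₂) _ _ _ _ (pow q₂ 4)
  numerator-match (suc m) = ≈-by-combination
    (solve 11 (λ x₂ x₃ x₄ p₃ p₄ p₅ κ o₀ o₁ oʳ oʳ₁ →
      let s₁ = μ-poly x₂ x₃ x₄ 0 1 ; s₂ = μ-poly x₂ x₃ x₄ 0 2 ; t₁ = μ-poly x₂ x₃ x₄ 1 0 ; t₂ = μ-poly x₂ x₃ x₄ 2 0
          α = μ-poly x₂ x₃ x₄ 1 1 ; β₁ = μ-poly x₂ x₃ x₄ 1 2 ; β₂ = μ-poly x₂ x₃ x₄ 2 1 ; γ = μ-poly x₂ x₃ x₄ 2 2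
          two = con (+ 2) in
      x₄ :* (s₁ :* (t₁ :* o₀ :- t₁ :* γ :* o₁ :+ β₁ :* t₂ :* o₁ :- β₁ :* t₂ :* κ :* oʳ₁)
             :+ s₂ :* (t₂ :* o₀ :- t₂ :* α :* o₁ :+ t₁ :* β₂ :* o₁
                       :- κ :* (t₂ :* oʳ :- t₂ :* α :* oʳ₁ :+ t₁ :* β₂ :* oʳ₁)))
      := x₂ :^ 4 :* ((x₃ :^ 2 :* x₄ :+ x₄) :* o₀
           :+ ((:- (x₃ :^ 2 :* x₄ :^ 2 :- two :* x₂ :* x₃ :^ 2 :* x₄ :^ 2 :+ x₃ :^ 4 :* x₄)) :* o₁
           :+ ((:- (p₃ :* p₄)) :* oʳ
           :+ ((p₅ :* p₄ :- two :* x₂ :* p₃ :* (x₄ :* p₄)) :* oʳ₁ :+ con (+ 0)))))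
         :+ (x₂ :^ 4 :* (oʳ :+ two :* x₂ :* x₄ :* oʳ₁ :- x₃ :^ 2 :* oʳ₁) :* (p₃ :* p₄ :- γ :* κ)
         :+ (:- (x₂ :^ 4 :* oʳ₁ :* p₄)) :* (p₅ :- p₃ :* x₃ :^ 2)))
      refl q₂ q₃ q₄ (pow q₃ (2 ℕ.* k)) (pow q₄ k) (pow q₃ (2 ℕ.* k ℕ.+ 2)) (pow (γ) r)
      (unit m) (shift 1 unit m) (shift r unit m) (shift (suc r) unit m))
    (residual≈0 _ (pow-γ k) ⊕0 residual≈0 _ (pow-+ q₃ (2 ℕ.* k) 2))

  closed-form : ∀ m → q₄ * cauchy (coeff denominator) D m ≈ pow q₂ 4 * coeff numerator m
  closed-form m = begin
    q₄ * cauchy (coeff denominator) D m                      ≈⟨ *-congˡ (cauchy-coeff denominator D m) ⟩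
    q₄ * termwise denominator D m                            ≈⟨ *-congˡ (denominator-match m) ⟩
    q₄ * den D m                                             ≈⟨ *-congˡ (den-D m) ⟩
    q₄ * (s₁ * shift 1 numY m + s₂ * shift 1 numU m)  ≈⟨ numerator-match m ⟩
    pow q₂ 4 * termwise numerator unit m                     ≈⟨ *-congˡ (coeff≈termwise-unit numerator m) ⟨
    pow q₂ 4 * coeff numerator m                             ∎

theorem3p1 : ∀ {c ℓ : Level} (R : CommutativeRing c ℓ) (k : ℕ) → k ≥ 2 →
  let open CommutativeRing R
      open RingStuff R
  in ∀ (q₂ q₃ q₄ : Carrier) (m : ℕ) →
    q₄ * cauchy (coeff ((0 , 1#)
                      ∷ (1 , - (pow q₃ 2 + q₄ * pow q₃ 2))
                      ∷ (2 , (q₄ * pow q₃ 4 - pow q₂ 2 * pow q₄ 2 * pow q₃ 2))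
                      ∷ (suc k , pow q₂ 2 * pow q₄ (suc k) * pow q₃ (2 ℕ.* k))
                      ∷ []))
                (Dcoeff k q₂ q₃ q₄) m
    ≈ pow q₂ 4 * coeff ((1 , (pow q₃ 2 * q₄ + q₄))
                      ∷ (2 , - (pow q₃ 2 * pow q₄ 2 - (1# + 1#) * q₂ * pow q₃ 2 * pow q₄ 2 + pow q₃ 4 * q₄))
                      ∷ (k , - (pow q₃ (2 ℕ.* k) * pow q₄ k))
                      ∷ (suc k , (pow q₃ (2 ℕ.* k ℕ.+ 2) * pow q₄ k - (1# + 1#) * q₂ * pow q₃ (2 ℕ.* k) * pow q₄ (suc k)))
                      ∷ []) m
theorem3p1 R zero    ()
-- The argument covers every k ≥ 1; the hypothesis k ≥ 2 only rules out k = 0.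
theorem3p1 R (suc r) _ = Transfer.closed-form R r
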